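{- $\sigma(C_4+P_2)=2$.
   Context: A graph $H=(V,E)$ is a sum graph if there is an injective map $\lambda:V\to\mathbb{N}$ with $E=\{xy : \exists z\in V,\ \lambda(z)=\lambda(x)+\lambda(y)\}$. For a graph $G$ without isolated vertices, $\sigma(G)$ is the minimum $k$ such that $G+N_k$ is a sum graph ($N_k$: $k$ isolated vertices, $+$: disjoint union). $C_4$ is the 4-cycle and $P_2$ is a single edge. -}

module Defs where

open import Data.Nat using (ℕ; zero; suc; _+_; _<_; _%_; _≡ᵇ_)
open import Data.Fin using (Fin; toℕ; splitAt)
open import Data.Fin.Properties using () renaming (_≟_ to _≟F_)
open import Data.Bool using (Bool; true; false; _∨_; not)
open import Data.Sum using (inj₁; inj₂)
open import Data.Product using (Σ; _×_; ∃)
open import Relation.Nullary using (¬_; does)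
open import Relation.Binary.PropositionalEquality using (_≡_; _≢_)
open import Function.Definitions using (Injective)
open import Function.Bundles using (_⇔_)

-- A finite simple graph on vertex set Fin n, given by a Boolean adjacency
-- function (all graphs built below are symmetric and loopless).
record Graph : Set where
  field
    n   : ℕ
    Adj : Fin n → Fin n → Bool
open Graph public

_⊕_ : Graph → Graph → Graph
G ⊕ H = record { n = n G + n H ; Adj = adj }
  where
  adj : Fin (n G + n H) → Fin (n G + n H) → Bool
  adj x y with splitAt (n G) x | splitAt (n G) y
  ... | inj₁ a | inj₁ b = Adj G a b
  ... | inj₂ a | inj₂ b = Adj H a b
  ... | _      | _      = false

C₄ : Graph
C₄ = record { n = 4 ; Adj = λ i j →
        (suc (toℕ i) % 4 ≡ᵇ toℕ j) ∨ (suc (toℕ j) % 4 ≡ᵇ toℕ i) }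

P₂ : Graph
P₂ = record { n = 2 ; Adj = λ i j → not (does (i ≟F j)) }

N : ℕ → Graph
N k = record { n = k ; Adj = λ _ _ → false }

IsSumGraph : Graph → Set
IsSumGraph H =
  Σ (Fin (n H) → ℕ) λ l →
    (∀ v → 0 < l v) ×
    Injective _≡_ _≡_ l ×
    (∀ x y → x ≢ y → ((Adj H x y ≡ true) ⇔ (∃ λ z → l z ≡ l x + l y)))

SumNumberIs : Graph → ℕ → Set
SumNumberIs G k = IsSumGraph (G ⊕ N k) × (∀ j → j < k → ¬ IsSumGraph (G ⊕ N j))

-- Upper bound: the labels 1, 2, 6, 11 on C₄, 3, 8 on P₂ and 12, 17 on two
-- isolated vertices form a sum labelling of C₄ + P₂ + N₂.
--
-- Lower bound: if u carries the largest label outside a vertex w, every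
-- neighbour y of u has λ u + λ y = λ w.  So with no isolated vertex the top
-- vertex has no neighbour at all, and with one isolated vertex the top vertex
-- of C₄ + P₂ has degree at most 1, hence lies on P₂.  Up to symmetry the labels
-- are then c on the top vertex of C₄, a < b on its neighbours, d opposite it,
-- p > c and q on P₂ and w = p + q.  Both c + a and c + b are labels above c,
-- which forces c + a = q and c + b = p; then d + a = b would make q + d = p a
-- label, so d + a = c, and d + b can only be q, giving b = 2a and q + a = p.
module Submission where

open import Defs
import Data.Nat as ℕ
open import Data.Nat using (ℕ; _+_; _<_; _≤_; _<?_; s≤s)
open import Data.Nat.Properties
open import Data.Fin using (Fin; zero; suc; punchIn; punchOut; _↑ˡ_)
open import Data.Fin.Properties using (all?; any?; punchIn-punchOut) renaming (_≟_ to _≟F_)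
open import Data.Fin.Permutation using (Permutation′; _⟨$⟩ʳ_; _⟨$⟩ˡ_; inverseˡ; inverseʳ; transpose; _∘ₚ_)
open import Data.List using (allFin)
open import Data.Vec using (_∷_; [])
import Data.Vec as Vec
open import Data.List.Extrema ≤-totalOrder using (argmax; f[xs]≤f[argmax])
open import Data.List.Membership.Propositional.Properties using (∈-allFin)
open import Data.List.Relation.Unary.All using (lookup)
open import Data.Bool using (true; false)
open import Data.Bool.Properties using () renaming (_≟_ to _≟B_)
open import Data.Product using (_×_; ∃; _,_; proj₁; proj₂)
open import Data.Empty using (⊥; ⊥-elim)
open import Data.Sum using (_⊎_; inj₁; inj₂)
open import Function using (_∘_)
open import Function.Bundles using (_⇔_; mk⇔; Equivalence)
open import Function.Definitions using (Injective)
open import Relation.Binary using (tri<; tri≈; tri>)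
open import Relation.Binary.PropositionalEquality
  using (_≡_; _≢_; refl; sym; trans; cong; subst; subst₂; module ≡-Reasoning)
open import Relation.Nullary using (¬_; Dec; yes; no; contradiction)
open import Relation.Nullary.Decidable using (True; toWitness; from-yes; map′; ¬?; _×-dec_; _→-dec_)

open ≡-Reasoning

argmax-Fin : ∀ {m} (f : Fin m → ℕ) → Fin m → ∃ λ u → ∀ v → f v ≤ f u
argmax-Fin {m} f v₀ =
  argmax f v₀ (allFin m) , λ v → lookup (f[xs]≤f[argmax] v₀ (allFin m)) (∈-allFin v)

argmax-avoiding : ∀ {m} (f : Fin (ℕ.suc m) → ℕ) (w : Fin (ℕ.suc m)) → Fin m →
                  ∃ λ k → ∀ v → v ≢ w → f v ≤ f (punchIn w k)
argmax-avoiding f w k₀ with argmax-Fin (f ∘ punchIn w) k₀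
... | k , max = k , λ v v≢w →
  subst (λ x → f x ≤ f (punchIn w k)) (punchIn-punchOut (v≢w ∘ sym)) (max (punchOut (v≢w ∘ sym)))

_⇔?_ : ∀ {A B : Set} → Dec A → Dec B → Dec (A ⇔ B)
a? ⇔? b? = map′ (λ (to , from) → mk⇔ to from) (λ e → Equivalence.to e , Equivalence.from e)
                ((a? →-dec b?) ×-dec (b? →-dec a?))

IsSumLabelling : (H : Graph) → (Fin (n H) → ℕ) → Set
IsSumLabelling H l =
  (∀ v → 0 < l v) ×
  Injective _≡_ _≡_ l ×
  (∀ x y → x ≢ y → ((Adj H x y ≡ true) ⇔ (∃ λ z → l z ≡ l x + l y)))

isSumLabelling? : (H : Graph) (l : Fin (n H) → ℕ) → Dec (IsSumLabelling H l)
isSumLabelling? H l =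
  all? (λ v → 0 <? l v) ×-dec
  map′ (λ inj {x} {y} → inj x y) (λ inj x y → inj)
       (all? λ x → all? λ y → (l x ≟ l y) →-dec (x ≟F y)) ×-dec
  all? λ x → all? λ y → ¬? (x ≟F y) →-dec
    ((Adj H x y ≟B true) ⇔? any? λ z → l z ≟ l x + l y)

module SumLabelling {H : Graph} {l : Fin (n H) → ℕ} (s : IsSumLabelling H l) where

  positive : ∀ v → 0 < l v
  positive = proj₁ s

  injective : Injective _≡_ _≡_ l
  injective = proj₁ (proj₂ s)

  Label : ℕ → Set
  Label v = ∃ λ z → l z ≡ v

  edge⇒label : ∀ {x y} → x ≢ y → Adj H x y ≡ true → Label (l x + l y)
  edge⇒label {x} {y} x≢y = Equivalence.to (proj₂ (proj₂ s) x y x≢y)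

  label⇒edge : ∀ {x y} → x ≢ y → Label (l x + l y) → Adj H x y ≡ true
  label⇒edge {x} {y} x≢y = Equivalence.from (proj₂ (proj₂ s) x y x≢y)

  non-edge⇒¬label : ∀ {x y} → x ≢ y → Adj H x y ≡ false → ¬ Label (l x + l y)
  non-edge⇒¬label x≢y non-adj lab with () ← trans (sym non-adj) (label⇒edge x≢y lab)

  ≤∧distinct⇒< : ∀ {x y} → l x ≤ l y → x ≢ y → l x < l y
  ≤∧distinct⇒< lx≤ly x≢y = ≤∧≢⇒< lx≤ly (x≢y ∘ injective)

  sum-label-exceeds : ∀ {x y z} → l z ≡ l x + l y → l x < l z
  sum-label-exceeds {x} {y} e = subst (l x <_) (sym e) (m<m+n (l x) (positive y))

  maximum-isolated : ∀ {u y} → (∀ v → l v ≤ l u) → u ≢ y → Adj H u y ≢ true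
  maximum-isolated max u≢y adj with z , e ← edge⇒label u≢y adj =
    <⇒≱ (sum-label-exceeds e) (max z)

  dominant-neighbour : ∀ {u w y} → (∀ v → v ≢ w → l v ≤ l u) →
                       u ≢ y → Adj H u y ≡ true → l w ≡ l u + l y
  dominant-neighbour {w = w} dom u≢y adj with z , e ← edge⇒label u≢y adj with z ≟F w
  ... | yes refl = e
  ... | no z≢w   = ⊥-elim (<⇒≱ (sum-label-exceeds e) (dom z z≢w))

  dominant-degree≤1 : ∀ {u w y₁ y₂} → (∀ v → v ≢ w → l v ≤ l u) →
                      u ≢ y₁ → Adj H u y₁ ≡ true → u ≢ y₂ → Adj H u y₂ ≡ true → y₁ ≡ y₂
  dominant-degree≤1 {u} dom u≢y₁ adj₁ u≢y₂ adj₂ = injective (+-cancelˡ-≡ (l u) _ _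
    (trans (sym (dominant-neighbour dom u≢y₁ adj₁)) (dominant-neighbour dom u≢y₂ adj₂)))

without-isolated⇒¬sum-graph : (H : Graph) → Fin (n H) →
  (∀ x → ∃ λ y → x ≢ y × Adj H x y ≡ true) → ¬ IsSumGraph H
without-isolated⇒¬sum-graph H v₀ neighbour (l , s)
  with u , max ← argmax-Fin l v₀
  with y , u≢y , adj ← neighbour u
  = SumLabelling.maximum-isolated s max u≢y adj

record Automorphism (H : Graph) : Set where
  field
    perm          : Permutation′ (n H)
    preserves-adj : ∀ x y → Adj H (perm ⟨$⟩ʳ x) (perm ⟨$⟩ʳ y) ≡ Adj H x y

automorphism : (H : Graph) (π : Permutation′ (n H)) →
  {True (all? λ x → all? λ y → Adj H (π ⟨$⟩ʳ x) (π ⟨$⟩ʳ y) ≟B Adj H x y)} → Automorphism H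
automorphism H π {preserves} = record { perm = π ; preserves-adj = toWitness preserves }

relabel : ∀ {H l} (α : Automorphism H) →
          IsSumLabelling H l → IsSumLabelling H (l ∘ (Automorphism.perm α ⟨$⟩ʳ_))
relabel {H} {l} α s = positive ∘ (π ⟨$⟩ʳ_) , π-injective ∘ injective , sums
  where
  open Automorphism α renaming (perm to π)
  open SumLabelling s

  π-injective : ∀ {x y} → π ⟨$⟩ʳ x ≡ π ⟨$⟩ʳ y → x ≡ y
  π-injective {x} {y} e = begin
    x                     ≡⟨ inverseˡ π ⟨
    π ⟨$⟩ˡ (π ⟨$⟩ʳ x)     ≡⟨ cong (π ⟨$⟩ˡ_) e ⟩
    π ⟨$⟩ˡ (π ⟨$⟩ʳ y)     ≡⟨ inverseˡ π ⟩
    y                     ∎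

  sums : ∀ x y → x ≢ y →
         (Adj H x y ≡ true) ⇔ (∃ λ z → l (π ⟨$⟩ʳ z) ≡ l (π ⟨$⟩ʳ x) + l (π ⟨$⟩ʳ y))
  sums x y x≢y = mk⇔ to from
    where
    πx≢πy = x≢y ∘ π-injective
    to : Adj H x y ≡ true → ∃ λ z → l (π ⟨$⟩ʳ z) ≡ l (π ⟨$⟩ʳ x) + l (π ⟨$⟩ʳ y)
    to adj with z , e ← edge⇒label πx≢πy (trans (preserves-adj x y) adj) =
      π ⟨$⟩ˡ z , trans (cong l (inverseʳ π)) e
    from : (∃ λ z → l (π ⟨$⟩ʳ z) ≡ l (π ⟨$⟩ʳ x) + l (π ⟨$⟩ʳ y)) → Adj H x y ≡ true
    from (z , e) = trans (sym (preserves-adj x y)) (label⇒edge πx≢πy (π ⟨$⟩ʳ z , e))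

pattern v0 = zero
pattern v1 = suc zero
pattern v2 = suc (suc zero)
pattern v3 = suc (suc (suc zero))
pattern v4 = suc (suc (suc (suc zero)))
pattern v5 = suc (suc (suc (suc (suc zero))))
pattern v6 = suc (suc (suc (suc (suc (suc zero)))))

G : ℕ → Graph
G k = (C₄ ⊕ P₂) ⊕ N k

C₄-vertex : Fin 4 → Fin 7
C₄-vertex k = k ↑ˡ 3

swap-P₂ : Automorphism (G 1)
swap-P₂ = automorphism (G 1) (transpose v4 v5)

reflect-C₄ : Automorphism (G 1)
reflect-C₄ = automorphism (G 1) (transpose v1 v3)

rotate-C₄ : Automorphism (G 1)
rotate-C₄ = automorphism (G 1) (transpose v2 v3 ∘ₚ transpose v1 v2 ∘ₚ transpose v0 v1)

-- c is the largest label on C₄ (at v0), a and b are the labels of its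
-- neighbours v1 and v3, d that of the opposite vertex v2; p ≥ q are the labels
-- on P₂ and w that of the isolated vertex.
record Normalised (l : Fin 7 → ℕ) : Set where
  field
    a≤c   : l v1 ≤ l v0
    d≤c   : l v2 ≤ l v0
    b≤c   : l v3 ≤ l v0
    c≤p   : l v0 ≤ l v4
    q≤p   : l v5 ≤ l v4
    w≡p+q : l v6 ≡ l v4 + l v5

module OrientedNormalForm {l : Fin 7 → ℕ} (s : IsSumLabelling (G 1) l) (nf : Normalised l)
                (a<b : l v1 < l v3) where
  open SumLabelling s
  open Normalised nf

  c a d b p q w : ℕ
  c = l v0
  a = l v1
  d = l v2
  b = l v3
  p = l v4
  q = l v5
  w = l v6

  b<c : b < c
  b<c = ≤∧distinct⇒< b≤c λ ()
  d<c : d < c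
  d<c = ≤∧distinct⇒< d≤c λ ()
  c<p : c < p
  c<p = ≤∧distinct⇒< c≤p λ ()
  q<p : q < p
  q<p = ≤∧distinct⇒< q≤p λ ()
  p≤w : p ≤ w
  p≤w = subst (p ≤_) (sym w≡p+q) (m≤m+n p q)
  q≤w : q ≤ w
  q≤w = subst (q ≤_) (sym w≡p+q) (m≤n+m q p)
  ca<cb : c + a < c + b
  ca<cb = +-monoʳ-< c a<b

  ¬label-q+a : ¬ Label (q + a)
  ¬label-q+a = non-edge⇒¬label {v5} {v1} (λ ()) refl

  ¬label-q+d : ¬ Label (q + d)
  ¬label-q+d = non-edge⇒¬label {v5} {v2} (λ ()) refl

  label-above-c : ∀ {x} → 0 < x → Label (c + x) → c + x ≡ p ⊎ c + x ≡ q ⊎ c + x ≡ w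
  label-above-c x>0 (v0 , e) = ⊥-elim (<⇒≢ (m<m+n c x>0) e)
  label-above-c x>0 (v1 , e) = ⊥-elim (<⇒≢ (≤-<-trans a≤c (m<m+n c x>0)) e)
  label-above-c x>0 (v2 , e) = ⊥-elim (<⇒≢ (≤-<-trans d≤c (m<m+n c x>0)) e)
  label-above-c x>0 (v3 , e) = ⊥-elim (<⇒≢ (≤-<-trans b≤c (m<m+n c x>0)) e)
  label-above-c x>0 (v4 , e) = inj₁ (sym e)
  label-above-c x>0 (v5 , e) = inj₂ (inj₁ (sym e))
  label-above-c x>0 (v6 , e) = inj₂ (inj₂ (sym e))

  c+a≡q×c+b≡p : c + a ≡ q × c + b ≡ p
  c+a≡q×c+b≡p with label-above-c (positive v1) (edge⇒label {v0} {v1} (λ ()) refl)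
             | label-above-c (positive v3) (edge⇒label {v0} {v3} (λ ()) refl)
  ... | inj₂ (inj₁ ca≡q) | inj₁ cb≡p        = ca≡q , cb≡p
  ... | inj₁ ca≡p        | inj₁ cb≡p        = ⊥-elim (<⇒≢ ca<cb (trans ca≡p (sym cb≡p)))
  ... | inj₂ (inj₁ ca≡q) | inj₂ (inj₁ cb≡q) = ⊥-elim (<⇒≢ ca<cb (trans ca≡q (sym cb≡q)))
  ... | inj₂ (inj₂ ca≡w) | inj₂ (inj₂ cb≡w) = ⊥-elim (<⇒≢ ca<cb (trans ca≡w (sym cb≡w)))
  ... | inj₁ ca≡p        | inj₂ (inj₁ cb≡q) = ⊥-elim (<-asym ca<cb (subst₂ _<_ (sym cb≡q) (sym ca≡p) q<p))
  ... | inj₂ (inj₂ ca≡w) | inj₁ cb≡p        = ⊥-elim (<⇒≱ ca<cb (subst₂ _≤_ (sym cb≡p) (sym ca≡w) p≤w))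
  ... | inj₂ (inj₂ ca≡w) | inj₂ (inj₁ cb≡q) = ⊥-elim (<⇒≱ ca<cb (subst₂ _≤_ (sym cb≡q) (sym ca≡w) q≤w))
  ... | inj₁ ca≡p        | inj₂ (inj₂ cb≡w) = ⊥-elim (¬label-q+a (v3 , b≡q+a))
    where
    b≡q+a : b ≡ q + a
    b≡q+a = +-cancelˡ-≡ c b (q + a) (begin
      c + b        ≡⟨ cb≡w ⟩
      w            ≡⟨ w≡p+q ⟩
      p + q        ≡⟨ cong (_+ q) ca≡p ⟨
      c + a + q    ≡⟨ +-assoc c a q ⟩
      c + (a + q)  ≡⟨ cong (c +_) (+-comm a q) ⟩
      c + (q + a)  ∎)
  ... | inj₂ (inj₁ ca≡q) | inj₂ (inj₂ cb≡w) = ⊥-elim (<⇒≢ (+-mono-<-≤ c<p b≤q) (trans cb≡w w≡p+q))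
    where
    b≤q : b ≤ q
    b≤q = subst (b ≤_) ca≡q (≤-trans (<⇒≤ b<c) (m≤m+n c a))

  ca≡q : c + a ≡ q
  ca≡q = proj₁ c+a≡q×c+b≡p

  cb≡p : c + b ≡ p
  cb≡p = proj₂ c+a≡q×c+b≡p

  d+a≢b : d + a ≢ b
  d+a≢b da≡b = ¬label-q+d (v4 , sym (begin
    q + d        ≡⟨ cong (_+ d) ca≡q ⟨
    c + a + d    ≡⟨ +-assoc c a d ⟩
    c + (a + d)  ≡⟨ cong (c +_) (+-comm a d) ⟩
    c + (d + a)  ≡⟨ cong (c +_) da≡b ⟩
    c + b        ≡⟨ cb≡p ⟩
    p            ∎))

  d+a<p : d + a < p
  d+a<p = subst (d + a <_) cb≡p (+-mono-< d<c a<b)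

  d+a≡c : d + a ≡ c
  d+a≡c with edge⇒label {v2} {v1} (λ ()) refl
  ... | v0 , e = sym e
  ... | v1 , e = ⊥-elim (<⇒≢ (m<n+m a (positive v2)) e)
  ... | v2 , e = ⊥-elim (<⇒≢ (m<m+n d (positive v1)) e)
  ... | v3 , e = ⊥-elim (d+a≢b (sym e))
  ... | v4 , e = ⊥-elim (>⇒≢ d+a<p e)
  ... | v5 , e = ⊥-elim (>⇒≢ (subst (d + a <_) ca≡q (+-monoˡ-< a d<c)) e)
  ... | v6 , e = ⊥-elim (>⇒≢ (<-≤-trans d+a<p p≤w) e)

  d+b<p : d + b < p
  d+b<p = subst (d + b <_) cb≡p (+-monoˡ-< b d<c)

  d+b≡q⇒q+a≡p : d + b ≡ q → q + a ≡ p
  d+b≡q⇒q+a≡p db≡q = begin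
    q + a        ≡⟨ cong (_+ a) ca≡q ⟨
    c + a + a    ≡⟨ +-assoc c a a ⟩
    c + (a + a)  ≡⟨ cong (c +_) b≡a+a ⟨
    c + b        ≡⟨ cb≡p ⟩
    p            ∎
    where
    b≡a+a : b ≡ a + a
    b≡a+a = +-cancelˡ-≡ d b (a + a) (begin
      d + b        ≡⟨ db≡q ⟩
      q            ≡⟨ ca≡q ⟨
      c + a        ≡⟨ cong (_+ a) d+a≡c ⟨
      d + a + a    ≡⟨ +-assoc d a a ⟩
      d + (a + a)  ∎)

  impossible : ⊥
  impossible with edge⇒label {v2} {v3} (λ ()) refl
  ... | v0 , e = <⇒≢ (subst (_< d + b) d+a≡c (+-monoʳ-< d a<b)) e
  ... | v1 , e = <⇒≢ (<-≤-trans a<b (m≤n+m b d)) e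
  ... | v2 , e = <⇒≢ (m<m+n d (positive v3)) e
  ... | v3 , e = <⇒≢ (m<n+m b (positive v2)) e
  ... | v4 , e = >⇒≢ d+b<p e
  ... | v5 , e = ¬label-q+a (v4 , sym (d+b≡q⇒q+a≡p (sym e)))
  ... | v6 , e = >⇒≢ (<-≤-trans d+b<p p≤w) e

¬normalised : ∀ {l} → IsSumLabelling (G 1) l → ¬ Normalised l
¬normalised {l} s nf with <-cmp (l v1) (l v3)
... | tri< a<b _ _ = OrientedNormalForm.impossible s nf a<b
... | tri≈ _ a≡b _ = contradiction (SumLabelling.injective s {v1} {v3} a≡b) λ ()
... | tri> _ _ b<a = OrientedNormalForm.impossible (relabel reflect-C₄ s) reflected b<a
  where
  open Normalised nf
  reflected : Normalised (l ∘ (Automorphism.perm reflect-C₄ ⟨$⟩ʳ_))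
  reflected = record { a≤c = b≤c ; d≤c = d≤c ; b≤c = a≤c ; c≤p = c≤p ; q≤p = q≤p ; w≡p+q = w≡p+q }

¬P₂-top : ∀ {l} → IsSumLabelling (G 1) l → ¬ (∀ v → v ≢ v6 → l v ≤ l v4)
¬P₂-top {l} s top = centre (argmax-Fin (l ∘ C₄-vertex) v0)
  where
  q≤p : l v5 ≤ l v4
  q≤p = top v5 (λ ())
  w≡p+q : l v6 ≡ l v4 + l v5
  w≡p+q = SumLabelling.dominant-neighbour s {v4} {v6} {v5} top (λ ()) refl
  ρ : ∀ {l′} → IsSumLabelling (G 1) l′ → IsSumLabelling (G 1) (l′ ∘ (Automorphism.perm rotate-C₄ ⟨$⟩ʳ_))
  ρ = relabel rotate-C₄

  centre : (∃ λ j → ∀ k → l (C₄-vertex k) ≤ l (C₄-vertex j)) → ⊥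
  centre (v0 , max) = ¬normalised s record
    { a≤c = max v1 ; d≤c = max v2 ; b≤c = max v3 ; c≤p = top v0 (λ ()) ; q≤p = q≤p ; w≡p+q = w≡p+q }
  centre (v1 , max) = ¬normalised (ρ s) record
    { a≤c = max v2 ; d≤c = max v3 ; b≤c = max v0 ; c≤p = top v1 (λ ()) ; q≤p = q≤p ; w≡p+q = w≡p+q }
  centre (v2 , max) = ¬normalised (ρ (ρ s)) record
    { a≤c = max v3 ; d≤c = max v0 ; b≤c = max v1 ; c≤p = top v2 (λ ()) ; q≤p = q≤p ; w≡p+q = w≡p+q }
  centre (v3 , max) = ¬normalised (ρ (ρ (ρ s))) record
    { a≤c = max v0 ; d≤c = max v1 ; b≤c = max v2 ; c≤p = top v3 (λ ()) ; q≤p = q≤p ; w≡p+q = w≡p+q }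

¬sum-labelling-G₁ : ∀ {l} → ¬ IsSumLabelling (G 1) l
¬sum-labelling-G₁ {l} s = on-top (argmax-avoiding l v6 v0)
  where
  open SumLabelling s
  σ = Automorphism.perm swap-P₂

  σ-fixes-v6 : ∀ {v} → σ ⟨$⟩ʳ v ≡ v6 → v ≡ v6
  σ-fixes-v6 e = trans (sym (inverseˡ σ)) (cong (σ ⟨$⟩ˡ_) e)

  on-top : (∃ λ k → ∀ v → v ≢ v6 → l v ≤ l (punchIn v6 k)) → ⊥
  on-top (v0 , top) = contradiction (dominant-degree≤1 {v0} {v6} {v1} {v3} top (λ ()) refl (λ ()) refl) λ ()
  on-top (v1 , top) = contradiction (dominant-degree≤1 {v1} {v6} {v0} {v2} top (λ ()) refl (λ ()) refl) λ ()
  on-top (v2 , top) = contradiction (dominant-degree≤1 {v2} {v6} {v1} {v3} top (λ ()) refl (λ ()) refl) λ ()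
  on-top (v3 , top) = contradiction (dominant-degree≤1 {v3} {v6} {v0} {v2} top (λ ()) refl (λ ()) refl) λ ()
  on-top (v4 , top) = ¬P₂-top s top
  on-top (v5 , top) = ¬P₂-top (relabel swap-P₂ s) λ v v≢v6 → top (σ ⟨$⟩ʳ v) (v≢v6 ∘ σ-fixes-v6)

¬sum-graph-G₀ : ¬ IsSumGraph (G 0)
¬sum-graph-G₀ = without-isolated⇒¬sum-graph (G 0) v0 λ where
  v0 → v1 , (λ ()) , refl
  v1 → v0 , (λ ()) , refl
  v2 → v1 , (λ ()) , refl
  v3 → v0 , (λ ()) , refl
  v4 → v5 , (λ ()) , refl
  v5 → v4 , (λ ()) , refl

label-G₂ : Fin 8 → ℕ
label-G₂ = Vec.lookup (1 ∷ 2 ∷ 6 ∷ 11 ∷ 3 ∷ 8 ∷ 12 ∷ 17 ∷ [])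

sum-labelling-G₂ : IsSumLabelling (G 2) label-G₂
sum-labelling-G₂ = from-yes (isSumLabelling? (G 2) label-G₂)

proposition15 : SumNumberIs (C₄ ⊕ P₂) 2
proposition15 = (label-G₂ , sum-labelling-G₂) , λ where
  0 _                     → ¬sum-graph-G₀
  1 _ (_ , s)             → ¬sum-labelling-G₁ s
  (ℕ.suc (ℕ.suc _)) (s≤s (s≤s ()))
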